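{- Let $M=M(S_0,\dots,S_r)$ be the freedom matroid of a flag on $S$, let $e\in S$, put $T_i=S_i\setminus e$ for all $i$, and let $k=\min\{i : e\in S_i\}$. Then the deletion is $M\setminus e=M(T_0,\dots,T_r)$ and the contraction is $M/e=M(T_0,\dots,T_{k-2},T_k,\dots,T_r)$.
   Context: A flag on a finite set $S$ is a sequence $(S_0,\dots,S_r)$ with $S_r=S$ and $S_{i-1}\subsetneq S_i$ for $1\le i\le r$. For any sequence $(U_0,\dots,U_m)$ of nested subsets with $U_m$ the ground set, $M(U_0,\dots,U_m)$ denotes the matroid whose independent sets are the sets $I$ with $|I\cap U_j|\le j$ for $0\le j\le m$, the bound for each set being its position $j$ in the sequence (so in $M(T_0,\dots,T_{k-2},T_k,\dots,T_r)$ the set $T_i$ with $i\ge k$ sits at position $i-1$). When $k=0$ the list $T_0,\dots,T_{k-2}$ is empty. -}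

module Defs where

open import Data.Nat using (ℕ; zero; suc; _≤_; _<_; _∸_)
open import Data.Fin using (Fin; toℕ; inject₁; fromℕ) renaming (suc to fsuc)
open import Data.Fin.Subset using (Subset; _⊆_; _⊂_; _∩_; _∪_; ⁅_⁆; ∣_∣; _∈_; _∉_; _-_; ⊤; ⊥)
open import Data.List using (List; []; _∷_; length; lookup; take; drop; _++_; tabulate)
open import Data.Product using (_×_; Σ)
open import Relation.Nullary using (¬_)
open import Relation.Binary.PropositionalEquality using (_≡_)

-- An independence system on a ground set E ⊆ Fin n (the elements outside E
-- are not part of the structure).
record IndepSystem (n : ℕ) : Set₁ where
  field
    ground : Subset n
    Indep  : Subset n → Set

open IndepSystem public

_≅_ : ∀ {n} → IndepSystem n → IndepSystem n → Set
M ≅ N = (ground M ≡ ground N) × (∀ I → (Indep M I → Indep N I) × (Indep N I → Indep M I))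

-- last element of a list (default ⊥ for the empty list, never used below)
lastOr : ∀ {n} → List (Subset n) → Subset n
lastOr []           = ⊥
lastOr (U ∷ [])     = U
lastOr (_ ∷ V ∷ Us) = lastOr (V ∷ Us)

freedom : ∀ {n} → List (Subset n) → IndepSystem n
freedom Us = record
  { ground = lastOr Us
  ; Indep  = λ I → (I ⊆ lastOr Us) × (∀ (j : Fin (length Us)) → ∣ I ∩ lookup Us j ∣ ≤ toℕ j)
  }

IsLoop : ∀ {n} → IndepSystem n → Fin n → Set
IsLoop M e = ¬ Indep M ⁅ e ⁆

deletion : ∀ {n} → IndepSystem n → Fin n → IndepSystem n
deletion M e = record
  { ground = ground M - e
  ; Indep  = λ I → (I ⊆ ground M - e) × Indep M I
  }

contraction : ∀ {n} → IndepSystem n → Fin n → IndepSystem n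
contraction M e = record
  { ground = ground M - e
  ; Indep  = λ I → (I ⊆ ground M - e)
                 × (IsLoop M e → Indep M I)
                 × (¬ IsLoop M e → Indep M (I ∪ ⁅ e ⁆))
  }

record IsFlag {n r : ℕ} (S : Fin (suc r) → Subset n) : Set where
  field
    top    : S (fromℕ r) ≡ ⊤
    strict : ∀ (i : Fin r) → S (inject₁ i) ⊂ S (fsuc i)

asList : ∀ {n r} → (Fin (suc r) → Subset n) → List (Subset n)
asList {r = r} S = tabulate S

contractList : ∀ {n} → List (Subset n) → ℕ → List (Subset n)
contractList Ts k = take (k ∸ 1) Ts ++ drop k Ts

-- Write c_i(I) = |I ∩ S_i|. Since no flag member below S_k contains e and every
-- member from S_k on does, for e ∉ I we have |(I ∪ e) ∩ S_i| = c_i(I) for i < k and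
-- = c_i(I) + 1 for i ≥ k. Deleting e only removes e from every S_i, which leaves
-- c_i(I) unchanged. If k = 0, e is a loop and M/e = M\e. Otherwise I ∪ e is
-- independent in M iff c_i(I) ≤ i for i < k and c_i(I) ≤ i - 1 for i ≥ k; these are
-- the constraints of M(T_0,…,T_{k-2},T_k,…,T_r) together with c_{k-1}(I) ≤ k - 1,
-- which is redundant because c_{k-1}(I) ≤ c_k(I) ≤ k - 1.
module Submission where

open import Defs
open import Data.Bool using (_∧_)
open import Data.Bool.Properties using (∨-identityʳ)
open import Data.Empty using (⊥-elim)
open import Data.Fin using (Fin; toℕ; inject₁; fromℕ) renaming (zero to fzero; suc to fsuc)
open import Data.Fin.Properties using (toℕ<n)
open import Data.Fin.Subset
  using (Subset; _⊆_; _∩_; _∪_; ⁅_⁆; ∣_∣; _∈_; _∉_; _-_; inside; outside)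
  renaming (⊥ to ∅)
open import Data.Fin.Subset.Properties
  using (p─⊥≡p; ∪-identityʳ; ∪-identityˡ; ∩-zeroˡ; ∣⊥∣≡0; ∉⊥; ∈⊤; x∈⁅x⁆; x∈p∩q⁺; x∈p∩q⁻;
         p⊆q⇒∣p∣≤∣q∣; p⊂q⇒p⊆q; x∈p⇒∣p-x∣<∣p∣)
open import Data.List using (List; []; _∷_; length; lookup; take; drop; _++_; tabulate)
open import Data.List.Properties using (length-tabulate)
open import Data.Nat using (ℕ; zero; suc; _≤_; _<_; z≤n; s≤s)
open import Data.Nat.Properties
  using (≤-refl; ≤-trans; ≤-reflexive; <⇒≤; <-≤-trans; ≤-pred; n≤1+n; n≮0; <-cmp; module ≤-Reasoning)
open import Data.Product using (_×_; Σ-syntax; _,_; proj₁; proj₂)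
open import Data.Sum using (_⊎_; inj₁; inj₂)
open import Data.Vec.Base using (_∷_; here; there)
open import Relation.Binary.Definitions using (tri<; tri≈; tri>)
open import Relation.Nullary using (¬_)
open import Relation.Binary.PropositionalEquality using (_≡_; refl; sym; trans; cong; cong₂; subst)

module _ {A : Set} where

  infix 4 _[_]=_

  data _[_]=_ : List A → ℕ → A → Set where
    at-head : ∀ {x xs} → (x ∷ xs) [ 0 ]= x
    at-tail : ∀ {y xs p x} → xs [ p ]= x → (y ∷ xs) [ suc p ]= x

  lookup-at : ∀ xs (j : Fin (length xs)) → xs [ toℕ j ]= lookup xs j
  lookup-at (x ∷ xs) fzero    = at-head
  lookup-at (x ∷ xs) (fsuc j) = at-tail (lookup-at xs j)

  at-lookup : ∀ {xs p x} → xs [ p ]= x → Σ[ j ∈ Fin (length xs) ] toℕ j ≡ p × lookup xs j ≡ x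
  at-lookup at-head = fzero , refl , refl
  at-lookup (at-tail a) with at-lookup a
  ... | j , refl , refl = fsuc j , refl , refl

  tabulate-at : ∀ {m} (f : Fin m → A) (i : Fin m) → tabulate f [ toℕ i ]= f i
  tabulate-at f fzero    = at-head
  tabulate-at f (fsuc i) = at-tail (tabulate-at (λ j → f (fsuc j)) i)

  at-tabulate : ∀ {m} (f : Fin m → A) {p x} → tabulate f [ p ]= x → Σ[ i ∈ Fin m ] toℕ i ≡ p × f i ≡ x
  at-tabulate {suc m} f at-head = fzero , refl , refl
  at-tabulate {suc m} f (at-tail a) with at-tabulate (λ j → f (fsuc j)) a
  ... | i , refl , refl = fsuc i , refl , refl

  -- contractList xs (suc t) is definitionally deleteAt t xs
  deleteAt : ℕ → List A → List A
  deleteAt t xs = take t xs ++ drop (suc t) xs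

  at-deleteAt⁻ : ∀ t {xs p x} → deleteAt t xs [ p ]= x
               → (p < t × xs [ p ]= x) ⊎ (t ≤ p × xs [ suc p ]= x)
  at-deleteAt⁻ zero    {_ ∷ _} a           = inj₂ (z≤n , at-tail a)
  at-deleteAt⁻ (suc t) {_ ∷ _} at-head     = inj₁ (s≤s z≤n , at-head)
  at-deleteAt⁻ (suc t) {_ ∷ _} (at-tail a) with at-deleteAt⁻ t a
  ... | inj₁ (p<t , b) = inj₁ (s≤s p<t , at-tail b)
  ... | inj₂ (t≤p , b) = inj₂ (s≤s t≤p , at-tail b)

  at-deleteAt⁺ˡ : ∀ {t xs p x} → p < t → xs [ p ]= x → deleteAt t xs [ p ]= x
  at-deleteAt⁺ˡ (s≤s _)   at-head     = at-head
  at-deleteAt⁺ˡ (s≤s p<t) (at-tail a) = at-tail (at-deleteAt⁺ˡ p<t a)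

  at-deleteAt⁺ʳ : ∀ t {xs p x} → t ≤ p → xs [ suc p ]= x → deleteAt t xs [ p ]= x
  at-deleteAt⁺ʳ zero    _         (at-tail a) = a
  at-deleteAt⁺ʳ (suc t) (s≤s t≤p) (at-tail a) = at-tail (at-deleteAt⁺ʳ t t≤p a)

x∉p⇒p∩[q-x]≡p∩q : ∀ {n} {x : Fin n} (p q : Subset n) → x ∉ p → p ∩ (q - x) ≡ p ∩ q
x∉p⇒p∩[q-x]≡p∩q {x = fzero}  (inside ∷ p)  q       x∉p = ⊥-elim (x∉p here)
x∉p⇒p∩[q-x]≡p∩q {x = fzero}  (outside ∷ p) (_ ∷ q) _   = cong (λ u → outside ∷ p ∩ u) (p─⊥≡p q)
x∉p⇒p∩[q-x]≡p∩q {x = fsuc x} (s ∷ p)       (t ∷ q) x∉p =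
  cong (_ ∷_) (x∉p⇒p∩[q-x]≡p∩q p q (λ x∈p → x∉p (there x∈p)))

x∉q⇒[p∪⁅x⁆]∩q≡p∩q : ∀ {n} {x : Fin n} (p q : Subset n) → x ∉ q → (p ∪ ⁅ x ⁆) ∩ q ≡ p ∩ q
x∉q⇒[p∪⁅x⁆]∩q≡p∩q {x = fzero}  (s ∷ p)       (inside ∷ q)  x∉q = ⊥-elim (x∉q here)
x∉q⇒[p∪⁅x⁆]∩q≡p∩q {x = fzero}  (inside ∷ p)  (outside ∷ q) _   = cong (λ u → outside ∷ u ∩ q) (∪-identityʳ p)
x∉q⇒[p∪⁅x⁆]∩q≡p∩q {x = fzero}  (outside ∷ p) (outside ∷ q) _   = cong (λ u → outside ∷ u ∩ q) (∪-identityʳ p)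
x∉q⇒[p∪⁅x⁆]∩q≡p∩q {x = fsuc x} (s ∷ p)       (t ∷ q)       x∉q =
  cong₂ _∷_ (cong (_∧ t) (∨-identityʳ s)) (x∉q⇒[p∪⁅x⁆]∩q≡p∩q p q (λ x∈q → x∉q (there x∈q)))

∣[p∪⁅x⁆]∩q∣≡1+∣p∩q∣ : ∀ {n} {x : Fin n} (p q : Subset n) → x ∉ p → x ∈ q
                    → ∣ (p ∪ ⁅ x ⁆) ∩ q ∣ ≡ suc ∣ p ∩ q ∣
∣[p∪⁅x⁆]∩q∣≡1+∣p∩q∣ {x = fzero}  (inside ∷ p)  q              x∉p _ = ⊥-elim (x∉p here)
∣[p∪⁅x⁆]∩q∣≡1+∣p∩q∣ {x = fzero}  (outside ∷ p) (inside ∷ q)   _   _ = cong (λ u → suc ∣ u ∩ q ∣) (∪-identityʳ p)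
∣[p∪⁅x⁆]∩q∣≡1+∣p∩q∣ {x = fsuc x} (inside ∷ p)  (inside ∷ q)   x∉p (there x∈q) =
  cong suc (∣[p∪⁅x⁆]∩q∣≡1+∣p∩q∣ p q (λ x∈p → x∉p (there x∈p)) x∈q)
∣[p∪⁅x⁆]∩q∣≡1+∣p∩q∣ {x = fsuc x} (outside ∷ p) (inside ∷ q)   x∉p (there x∈q) =
  ∣[p∪⁅x⁆]∩q∣≡1+∣p∩q∣ p q (λ x∈p → x∉p (there x∈p)) x∈q
∣[p∪⁅x⁆]∩q∣≡1+∣p∩q∣ {x = fsuc x} (inside ∷ p)  (outside ∷ q)  x∉p (there x∈q) =
  ∣[p∪⁅x⁆]∩q∣≡1+∣p∩q∣ p q (λ x∈p → x∉p (there x∈p)) x∈q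
∣[p∪⁅x⁆]∩q∣≡1+∣p∩q∣ {x = fsuc x} (outside ∷ p) (outside ∷ q)  x∉p (there x∈q) =
  ∣[p∪⁅x⁆]∩q∣≡1+∣p∩q∣ p q (λ x∈p → x∉p (there x∈p)) x∈q

∣p∩q∣≤∣p∩r∣ : ∀ {n} (p : Subset n) {q r : Subset n} → q ⊆ r → ∣ p ∩ q ∣ ≤ ∣ p ∩ r ∣
∣p∩q∣≤∣p∩r∣ p {q} q⊆r = p⊆q⇒∣p∣≤∣q∣ λ y∈p∩q →
  let (y∈p , y∈q) = x∈p∩q⁻ p q y∈p∩q in x∈p∩q⁺ (y∈p , q⊆r y∈q)

x∉q-x : ∀ {n} (q : Subset n) (x : Fin n) → x ∉ q - x
x∉q-x (_ ∷ q) fzero    ()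
x∉q-x (_ ∷ q) (fsuc x) (there x∈q) = x∉q-x q x x∈q

module _ {n : ℕ} where

  lastOr-tabulate : ∀ {r} (f : Fin (suc r) → Subset n) → lastOr (tabulate f) ≡ f (fromℕ r)
  lastOr-tabulate {zero}  f = refl
  lastOr-tabulate {suc r} f = lastOr-tabulate (λ j → f (fsuc j))

  lastOr-deleteAt : ∀ t (xs : List (Subset n)) → suc t < length xs → lastOr (deleteAt t xs) ≡ lastOr xs
  lastOr-deleteAt zero          (x ∷ y ∷ ys)     _         = refl
  lastOr-deleteAt (suc zero)    (x ∷ y ∷ z ∷ zs) _         = refl
  lastOr-deleteAt (suc (suc t)) (x ∷ y ∷ ys)     (s≤s t<l) = lastOr-deleteAt (suc t) (y ∷ ys) t<l
  lastOr-deleteAt zero          (x ∷ [])         (s≤s ())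
  lastOr-deleteAt (suc zero)    (x ∷ [])         (s≤s ())
  lastOr-deleteAt (suc zero)    (x ∷ y ∷ [])     (s≤s (s≤s ()))

  chain-mono : ∀ {r} {S : Fin (suc r) → Subset n} → (∀ i → S (inject₁ i) ⊆ S (fsuc i))
             → ∀ {i j} → toℕ i ≤ toℕ j → S i ⊆ S j
  chain-mono         step {fzero}  {fzero}  _         x∈ = x∈
  chain-mono {suc r} step {fzero}  {fsuc j} _         x∈ =
    chain-mono (λ i → step (fsuc i)) {fzero} {j} z≤n (step fzero x∈)
  chain-mono {suc r} step {fsuc i} {fsuc j} (s≤s i≤j) x∈ = chain-mono (λ i → step (fsuc i)) i≤j x∈

  Capped : List (Subset n) → Subset n → Set
  Capped xs I = ∀ {p x} → xs [ p ]= x → ∣ I ∩ x ∣ ≤ p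

  freedom-capped⁻ : ∀ {xs I} → Indep (freedom xs) I → Capped xs I
  freedom-capped⁻ (_ , bound) a with at-lookup a
  ... | j , refl , refl = bound j

  freedom-capped⁺ : ∀ {xs I} → I ⊆ lastOr xs → Capped xs I → Indep (freedom xs) I
  freedom-capped⁺ {xs} I⊆ cap = I⊆ , λ j → cap (lookup-at xs j)

  capped-tabulate⁻ : ∀ {m} (f : Fin m → Subset n) I → Capped (tabulate f) I → ∀ i → ∣ I ∩ f i ∣ ≤ toℕ i
  capped-tabulate⁻ f I cap i = cap (tabulate-at f i)

  capped-tabulate⁺ : ∀ {m} (f : Fin m → Subset n) I → (∀ i → ∣ I ∩ f i ∣ ≤ toℕ i) → Capped (tabulate f) I
  capped-tabulate⁺ f I bound a with at-tabulate f a
  ... | i , refl , refl = bound i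

  capped-deleteAt-tabulate⁻ : ∀ t {m} (f : Fin m → Subset n) I → Capped (deleteAt t (tabulate f)) I
                            → (∀ i → toℕ i < t → ∣ I ∩ f i ∣ ≤ toℕ i) × (∀ i → t < toℕ i → ∣ I ∩ f i ∣ < toℕ i)
  capped-deleteAt-tabulate⁻ t f I cap = below , above
    where
    below : ∀ i → toℕ i < t → ∣ I ∩ f i ∣ ≤ toℕ i
    below i i<t = cap (at-deleteAt⁺ˡ i<t (tabulate-at f i))
    above : ∀ i → t < toℕ i → ∣ I ∩ f i ∣ < toℕ i
    above (fsuc i) (s≤s t≤i) = s≤s (cap (at-deleteAt⁺ʳ t t≤i (tabulate-at f (fsuc i))))

  capped-deleteAt-tabulate⁺ : ∀ t {m} (f : Fin m → Subset n) I
                            → (∀ i → toℕ i < t → ∣ I ∩ f i ∣ ≤ toℕ i) → (∀ i → t < toℕ i → ∣ I ∩ f i ∣ < toℕ i)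
                            → Capped (deleteAt t (tabulate f)) I
  capped-deleteAt-tabulate⁺ t f I below above a with at-deleteAt⁻ t a
  ... | inj₁ (p<t , b) with at-tabulate f b
  ...   | i , refl , refl = below i p<t
  capped-deleteAt-tabulate⁺ t f I below above a | inj₂ (t≤p , b) with at-tabulate f b
  ...   | i , i≡1+p , refl =
    ≤-pred (subst (suc ∣ I ∩ f i ∣ ≤_) i≡1+p (above i (subst (t <_) (sym i≡1+p) (s≤s t≤p))))

  capped-∅ : ∀ {xs} → Capped xs ∅
  capped-∅ {p = p} {x} _ = subst (_≤ p) (sym (trans (cong ∣_∣ (∩-zeroˡ x)) (∣⊥∣≡0 n))) z≤n

  freedom-loop : ∀ {x xs} {e : Fin n} → e ∈ x → IsLoop (freedom (x ∷ xs)) e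
  freedom-loop {x} {e = e} e∈x indep =
    n≮0 (<-≤-trans (x∈p⇒∣p-x∣<∣p∣ (x∈p∩q⁺ (x∈⁅x⁆ e , e∈x))) (freedom-capped⁻ indep at-head))

  ≅-trans : ∀ {L M N : IndepSystem n} → L ≅ M → M ≅ N → L ≅ N
  ≅-trans (gLM , iLM) (gMN , iMN) = trans gLM gMN , λ I →
      (λ h → proj₁ (iMN I) (proj₁ (iLM I) h))
    , (λ h → proj₂ (iLM I) (proj₂ (iMN I) h))

  contraction≅deletion : ∀ (M : IndepSystem n) {e} → IsLoop M e → contraction M e ≅ deletion M e
  contraction≅deletion M loop = refl , λ I →
      (λ (I⊆ , ifLoop , _) → I⊆ , ifLoop loop)
    , (λ (I⊆ , indep) → I⊆ , (λ _ → indep) , λ nonloop → ⊥-elim (nonloop loop))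

module FlagMinors {n r} {S : Fin (suc r) → Subset n} (flag : IsFlag S) (e : Fin n) where
  open IsFlag flag

  T : Fin (suc r) → Subset n
  T i = S i - e

  M : IndepSystem n
  M = freedom (asList S)

  S-mono : ∀ {i j} → toℕ i ≤ toℕ j → S i ⊆ S j
  S-mono = chain-mono (λ j → p⊂q⇒p⊆q (strict j))

  ⊆-ground : ∀ {I} → I ⊆ lastOr (asList S)
  ⊆-ground _ = subst (_ ∈_) (sym (trans (lastOr-tabulate S) top)) ∈⊤

  indep⁺ : ∀ I → (∀ i → ∣ I ∩ S i ∣ ≤ toℕ i) → Indep M I
  indep⁺ I bound = freedom-capped⁺ ⊆-ground (capped-tabulate⁺ S I bound)

  ground-deletion : lastOr (asList S) - e ≡ lastOr (asList T)
  ground-deletion = trans (cong (_- e) (lastOr-tabulate S)) (sym (lastOr-tabulate T))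

  ⊆-e⇒e∉ : ∀ {I} → I ⊆ lastOr (asList S) - e → e ∉ I
  ⊆-e⇒e∉ I⊆ e∈I = x∉q-x (lastOr (asList S)) e (I⊆ e∈I)

  ∣I∩T∣≡∣I∩S∣ : ∀ I → e ∉ I → ∀ i → ∣ I ∩ T i ∣ ≡ ∣ I ∩ S i ∣
  ∣I∩T∣≡∣I∩S∣ I e∉I i = cong ∣_∣ (x∉p⇒p∩[q-x]≡p∩q I (S i) e∉I)

  deletion≅ : deletion M e ≅ freedom (asList T)
  deletion≅ = ground-deletion , λ I →
      (λ (I⊆ , indep) → freedom-capped⁺ (subst (I ⊆_) ground-deletion I⊆) (capped-tabulate⁺ T I λ i →
         subst (_≤ toℕ i) (sym (∣I∩T∣≡∣I∩S∣ I (⊆-e⇒e∉ I⊆) i))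
               (capped-tabulate⁻ S I (freedom-capped⁻ indep) i)))
    , (λ indep → let I⊆ = subst (I ⊆_) (sym ground-deletion) (proj₁ indep) in
         I⊆ , indep⁺ I λ i →
         subst (_≤ toℕ i) (∣I∩T∣≡∣I∩S∣ I (⊆-e⇒e∉ I⊆) i) (capped-tabulate⁻ T I (freedom-capped⁻ indep) i))

  module NonLoop (k : Fin r) (e∈Sk : e ∈ S (fsuc k)) (e∉before : ∀ i → toℕ i < suc (toℕ k) → e ∉ S i) where

    m : ℕ
    m = toℕ k

    e∈after : ∀ i → m < toℕ i → e ∈ S i
    e∈after i m<i = S-mono {fsuc k} m<i e∈Sk

    ∣[I∪e]∩S∣≡∣I∩T∣ : ∀ I → e ∉ I → ∀ i → toℕ i ≤ m → ∣ (I ∪ ⁅ e ⁆) ∩ S i ∣ ≡ ∣ I ∩ T i ∣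
    ∣[I∪e]∩S∣≡∣I∩T∣ I e∉I i i≤m =
      trans (cong ∣_∣ (x∉q⇒[p∪⁅x⁆]∩q≡p∩q I (S i) (e∉before i (s≤s i≤m)))) (sym (∣I∩T∣≡∣I∩S∣ I e∉I i))

    ∣[I∪e]∩S∣≡1+∣I∩T∣ : ∀ I → e ∉ I → ∀ i → m < toℕ i → ∣ (I ∪ ⁅ e ⁆) ∩ S i ∣ ≡ suc ∣ I ∩ T i ∣
    ∣[I∪e]∩S∣≡1+∣I∩T∣ I e∉I i m<i =
      trans (∣[p∪⁅x⁆]∩q∣≡1+∣p∩q∣ I (S i) e∉I (e∈after i m<i)) (cong suc (sym (∣I∩T∣≡∣I∩S∣ I e∉I i)))

    indep-∪⁅e⁆⇒capped : ∀ {I} → e ∉ I → Indep M (I ∪ ⁅ e ⁆) → Capped (deleteAt m (asList T)) I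
    indep-∪⁅e⁆⇒capped {I} e∉I indep = capped-deleteAt-tabulate⁺ m T I
        (λ i i<m → subst (_≤ toℕ i) (∣[I∪e]∩S∣≡∣I∩T∣ I e∉I i (<⇒≤ i<m)) (bound i))
        (λ i m<i → subst (_≤ toℕ i) (∣[I∪e]∩S∣≡1+∣I∩T∣ I e∉I i m<i) (bound i))
      where
      bound : ∀ i → ∣ (I ∪ ⁅ e ⁆) ∩ S i ∣ ≤ toℕ i
      bound = capped-tabulate⁻ S (I ∪ ⁅ e ⁆) (freedom-capped⁻ indep)

    capped⇒indep-∪⁅e⁆ : ∀ {I} → e ∉ I → Capped (deleteAt m (asList T)) I → Indep M (I ∪ ⁅ e ⁆)
    capped⇒indep-∪⁅e⁆ {I} e∉I cap = indep⁺ (I ∪ ⁅ e ⁆) bound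
      where
      below : ∀ i → toℕ i < m → ∣ I ∩ T i ∣ ≤ toℕ i
      below = proj₁ (capped-deleteAt-tabulate⁻ m T I cap)
      above : ∀ i → m < toℕ i → ∣ I ∩ T i ∣ < toℕ i
      above = proj₂ (capped-deleteAt-tabulate⁻ m T I cap)
      bound : ∀ i → ∣ (I ∪ ⁅ e ⁆) ∩ S i ∣ ≤ toℕ i
      bound i with <-cmp (toℕ i) m
      ... | tri< i<m _ _ = subst (_≤ toℕ i) (sym (∣[I∪e]∩S∣≡∣I∩T∣ I e∉I i (<⇒≤ i<m))) (below i i<m)
      ... | tri> _ _ m<i = subst (_≤ toℕ i) (sym (∣[I∪e]∩S∣≡1+∣I∩T∣ I e∉I i m<i)) (above i m<i)
      ... | tri≈ _ i≡m _ = begin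
        ∣ (I ∪ ⁅ e ⁆) ∩ S i ∣  ≡⟨ ∣[I∪e]∩S∣≡∣I∩T∣ I e∉I i (≤-reflexive i≡m) ⟩
        ∣ I ∩ T i ∣            ≡⟨ ∣I∩T∣≡∣I∩S∣ I e∉I i ⟩
        ∣ I ∩ S i ∣            ≤⟨ ∣p∩q∣≤∣p∩r∣ I (S-mono {i} {fsuc k} i≤1+m) ⟩
        ∣ I ∩ S (fsuc k) ∣     ≡⟨ ∣I∩T∣≡∣I∩S∣ I e∉I (fsuc k) ⟨
        ∣ I ∩ T (fsuc k) ∣     ≤⟨ ≤-pred (above (fsuc k) ≤-refl) ⟩
        m                      ≡⟨ i≡m ⟨
        toℕ i                  ∎
        where
        open ≤-Reasoning
        i≤1+m : toℕ i ≤ suc m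
        i≤1+m = ≤-trans (≤-reflexive i≡m) (n≤1+n m)

    nonloop : ¬ IsLoop M e
    nonloop loop = loop (subst (Indep M) (∪-identityˡ ⁅ e ⁆) (capped⇒indep-∪⁅e⁆ ∉⊥ capped-∅))

    ground-contraction : lastOr (asList S) - e ≡ lastOr (deleteAt m (asList T))
    ground-contraction = trans ground-deletion (sym (lastOr-deleteAt m (asList T) 1+m<length))
      where
      1+m<length : suc m < length (asList T)
      1+m<length = subst (suc m <_) (sym (length-tabulate T)) (s≤s (toℕ<n k))

    contraction≅ : contraction M e ≅ freedom (deleteAt m (asList T))
    contraction≅ = ground-contraction , λ I →
        (λ (I⊆ , _ , ifNonloop) → freedom-capped⁺ (subst (I ⊆_) ground-contraction I⊆)
                                    (indep-∪⁅e⁆⇒capped (⊆-e⇒e∉ I⊆) (ifNonloop nonloop)))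
      , (λ indep → let I⊆ = subst (I ⊆_) (sym ground-contraction) (proj₁ indep) in
           I⊆ , (λ loop → ⊥-elim (nonloop loop))
              , λ _ → capped⇒indep-∪⁅e⁆ (⊆-e⇒e∉ I⊆) (freedom-capped⁻ indep))

proposition5p2 : ∀ {n r : ℕ} (S : Fin (suc r) → Subset n) → IsFlag S
    → (e : Fin n) (k : Fin (suc r))
    → e ∈ S k → (∀ (i : Fin (suc r)) → toℕ i < toℕ k → e ∉ S i)
    → (deletion (freedom (asList S)) e ≅ freedom (asList (λ i → S i - e)))
      × (contraction (freedom (asList S)) e ≅ freedom (contractList (asList (λ i → S i - e)) (toℕ k)))
proposition5p2 S flag e fzero e∈S₀ _ =
  deletion≅ , ≅-trans (contraction≅deletion M (freedom-loop e∈S₀)) deletion≅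
  where open FlagMinors flag e
proposition5p2 S flag e (fsuc k) e∈Sk e∉before = deletion≅ , contraction≅
  where open FlagMinors flag e
        open NonLoop k e∈Sk e∉before
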